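{- Let $(f,g,d,h,m)$ be an NCS system over a unital associative $K$-algebra $A$, with coefficients written as $f(t)=\sum_{m\ge0}t^m\lambda_m$, $g(t)=\sum_{m\ge0}t^ms_m$, $d(t)=\sum_{m\ge1}\frac{t^m}{m}\phi_m$, $h(t)=\sum_{m\ge1}t^{m-1}\psi_m$, $m(t)=\sum_{m\ge1}t^{m-1}\xi_m$. For a sequence $w=\{w_m\}_{m\ge1}$ of elements of $A$ let $K\langle w\rangle$ denote the unital $K$-subalgebra of $A$ generated by the $w_m$. Then for each of $w=s,\phi,\psi,\xi$ (indexed by $m\ge1$) we have $K\langle w\rangle=K\langle\lambda\rangle$, where $\lambda=\{\lambda_m\}_{m\ge1}$.
   Context: $K$ is a unital commutative $\mathbb{Q}$-algebra; $t$ is a formal central parameter. An NCS system over $A$ is a $5$-tuple $(f(t),g(t),d(t),h(t),m(t))\in A[[t]]^{\times5}$ with $d(0)=0$ satisfying $f(0)=1$; $f(-t)g(t)=g(t)f(-t)=1$; $e^{d(t)}=g(t)$ (with $e^{d(t)}=\sum_{k\ge0}d(t)^k/k!$); $g'(t)=g(t)h(t)$; $g'(t)=m(t)g(t)$, where $'$ denotes $d/dt$. -}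

module Defs where

open import Level using (Level; _⊔_) renaming (suc to lsuc)
open import Algebra.Bundles using (CommutativeRing; Ring)
open import Data.Nat using (ℕ; zero; suc; _∸_)
open import Data.Product using (Σ; _×_; proj₁)

module _ {k kℓ} (K : CommutativeRing k kℓ) where
  open CommutativeRing K

  fromℕK : ℕ → Carrier
  fromℕK zero = 0#
  fromℕK (suc n) = 1# + fromℕK n

  -- K is a ℚ-algebra: every positive integer is invertible in K
  -- (a chosen inverse of n+1 is part of the data).
  IsQAlgebra : Set (k ⊔ kℓ)
  IsQAlgebra = (n : ℕ) → Σ Carrier (λ u → (fromℕK (suc n) * u) ≈ 1#)

record IsKAlgebra {k kℓ a aℓ} (K : CommutativeRing k kℓ) (A : Ring a aℓ)
                  : Set (k ⊔ kℓ ⊔ a ⊔ aℓ) where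
  private
    module K = CommutativeRing K
    module A = Ring A
  infixr 7 _·_
  field
    _·_        : K.Carrier → A.Carrier → A.Carrier
    ·-cong     : ∀ {r s x y} → r K.≈ s → x A.≈ y → (r · x) A.≈ (s · y)
    ·-distribʳ : ∀ r s x → ((r K.+ s) · x) A.≈ ((r · x) A.+ (s · x))
    ·-distribˡ : ∀ r x y → (r · (x A.+ y)) A.≈ ((r · x) A.+ (r · y))
    ·-assoc    : ∀ r s x → ((r K.* s) · x) A.≈ (r · (s · x))
    ·-identity : ∀ x → (K.1# · x) A.≈ x
    ·-*-assocˡ : ∀ r x y → (r · (x A.* y)) A.≈ ((r · x) A.* y)
    ·-*-assocʳ : ∀ r x y → (r · (x A.* y)) A.≈ (x A.* (r · y))

module Series {k kℓ a aℓ} {K : CommutativeRing k kℓ} {A : Ring a aℓ}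
              (alg : IsKAlgebra K A) (q : IsQAlgebra K) where
  private
    module K = CommutativeRing K
  open Ring A
  open IsKAlgebra alg

  PS : Set a
  PS = ℕ → Carrier

  _≋_ : PS → PS → Set aℓ
  u ≋ v = ∀ n → u n ≈ v n

  sumTo : (ℕ → Carrier) → ℕ → Carrier
  sumTo u zero = 0#
  sumTo u (suc n) = sumTo u n + u n

  oneS : PS
  oneS zero = 1#
  oneS (suc n) = 0#

  -- Cauchy product (t central): (u v)_n = Σ_{i ≤ n} u_i v_{n-i}
  _⋆_ : PS → PS → PS
  (u ⋆ v) n = sumTo (λ i → u i * v (n ∸ i)) (suc n)

  -- u(-t): coefficient n is (-1)^n u_n
  alt : ℕ → Carrier → Carrier
  alt zero x = x
  alt (suc n) x = - alt n x

  negT : PS → PS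
  negT u n = alt n (u n)

  deriv : PS → PS
  deriv u n = fromℕK K (suc n) · u (suc n)

  powS : PS → ℕ → PS
  powS u zero = oneS
  powS u (suc j) = u ⋆ powS u j

  invFact : ℕ → K.Carrier
  invFact zero = K.1#
  invFact (suc j) = invFact j K.* proj₁ (q j)

  -- e^{d(t)} = Σ_j d(t)^j / j!, for d(0) = 0; the coefficient of t^n
  -- only receives contributions from j ≤ n.
  expS : PS → PS
  expS u n = sumTo (λ j → invFact j · powS u j n) (suc n)

  record IsNCS (f g d h m : PS) : Set aℓ where
    field
      f0     : f 0 ≈ 1#
      d0     : d 0 ≈ 0#
      fg-inv : (negT f ⋆ g) ≋ oneS
      gf-inv : (g ⋆ negT f) ≋ oneS
      exp-d  : expS d ≋ g
      g'-gh  : deriv g ≋ (g ⋆ h)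
      g'-mg  : deriv g ≋ (m ⋆ g)

  -- K⟨w⟩ for a sequence w = {w_m}_{m ≥ 1}, given as w' with w' i = w_{i+1}:
  -- the unital K-subalgebra of A generated by the w_m (inductively:
  -- smallest subset containing the generators and 1, closed under
  -- K-scalar multiplication, addition, multiplication, and ≈).
  data InSub (w : ℕ → Carrier) : Carrier → Set (k ⊔ a ⊔ aℓ) where
    gen  : ∀ i → InSub w (w i)
    one  : InSub w 1#
    scal : ∀ r {x} → InSub w x → InSub w (r · x)
    add  : ∀ {x y} → InSub w x → InSub w y → InSub w (x + y)
    mul  : ∀ {x y} → InSub w x → InSub w y → InSub w (x * y)
    resp : ∀ {x y} → x ≈ y → InSub w x → InSub w y

  SameSub : (ℕ → Carrier) → (ℕ → Carrier) → Set (k ⊔ a ⊔ aℓ)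
  SameSub w v = ∀ x → (InSub w x → InSub v x) × (InSub v x → InSub w x)

  -- Coefficient sequences (index i stands for m = i + 1):
  -- λ_m = f_m, s_m = g_m, φ_m = m d_m, ψ_m = h_{m-1}, ξ_m = m_{m-1}.
  lamSeq : PS → ℕ → Carrier
  lamSeq f i = f (suc i)

  sSeq : PS → ℕ → Carrier
  sSeq g i = g (suc i)

  phiSeq : PS → ℕ → Carrier
  phiSeq d i = fromℕK K (suc i) · d (suc i)

  psiSeq : PS → ℕ → Carrier
  psiSeq h i = h i

  xiSeq : PS → ℕ → Carrier
  xiSeq m i = m i

module Submission where

-- The relations f(-t) g = g f(-t) = 1, g' = g h = m g and g = e^d with d(0) = 0 are
-- triangular: each coefficient of one series equals a nonzero integer multiple of a
-- coefficient of another plus a noncommutative polynomial in earlier coefficients.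
-- Since K contains ℚ these relations can be solved either way, so strong induction
-- on the index puts the coefficients of f, d, h and m in the subalgebra generated
-- by those of g, and conversely.

open import Defs
open import Algebra.Bundles using (CommutativeRing; Ring)
import Algebra.Properties.Group as GroupProperties
open import Data.Nat using (ℕ; zero; suc; _∸_; _<_; _≤_; s≤s; s≤s⁻¹)
open import Data.Nat.Induction using (<-rec)
open import Data.Nat.Properties using (n∸n≡0; m∸n≤m; <-trans; <⇒≤; n<1+n)
open import Data.Product using (_×_; _,_; proj₁; proj₂)
import Relation.Binary.PropositionalEquality as ≡
import Relation.Binary.Reasoning.Setoid as SetoidReasoning

module _ {k kℓ a aℓ} {K : CommutativeRing k kℓ} {A : Ring a aℓ}
         (alg : IsKAlgebra K A) (q : IsQAlgebra K) where

  private module K = CommutativeRing K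
  open Ring A hiding (zero)
  open GroupProperties +-group
    using (identityˡ-unique; inverseʳ-unique; ⁻¹-involutive; //-rightDividesʳ; \\-leftDividesʳ)
  open IsKAlgebra alg
  open Series alg q
  open SetoidReasoning setoid

  ∸-suc< : ∀ {n i} → i < n → n ∸ suc i < n
  ∸-suc< {suc n} {i} _ = s≤s (m∸n≤m n i)

  ·-zeroˡ : ∀ x → K.0# · x ≈ 0#
  ·-zeroˡ x = identityˡ-unique (K.0# · x) (K.0# · x)
    (sym (trans (·-cong (K.sym (K.+-identityˡ K.0#)) refl) (·-distribʳ _ _ _)))

  -1·x≈-x : ∀ x → (K.- K.1#) · x ≈ - x
  -1·x≈-x x = inverseʳ-unique x _ (begin
    x + (K.- K.1#) · x              ≈⟨ +-cong (sym (·-identity x)) refl ⟩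
    K.1# · x + (K.- K.1#) · x       ≈⟨ sym (·-distribʳ _ _ _) ⟩
    (K.1# K.+ K.- K.1#) · x         ≈⟨ ·-cong (K.-‿inverseʳ K.1#) refl ⟩
    K.0# · x                        ≈⟨ ·-zeroˡ x ⟩
    0#                              ∎)

  inverse-·-fromℕK : ∀ n x → proj₁ (q n) · (fromℕK K (suc n) · x) ≈ x
  inverse-·-fromℕK n x = begin
    proj₁ (q n) · (fromℕK K (suc n) · x)   ≈⟨ sym (·-assoc _ _ _) ⟩
    (proj₁ (q n) K.* fromℕK K (suc n)) · x ≈⟨ ·-cong (K.trans (K.*-comm _ _) (proj₂ (q n))) refl ⟩
    K.1# · x                               ≈⟨ ·-identity x ⟩
    x                                      ∎

  invFact-1 : invFact 1 K.≈ K.1#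
  invFact-1 = K.trans (K.*-identityˡ _) (K.trans (K.sym (K.*-identityˡ _))
                (K.trans (K.*-cong (K.sym (K.+-identityʳ K.1#)) K.refl) (proj₂ (q 0))))

  sumTo-head : ∀ u n → sumTo u (suc n) ≈ u 0 + sumTo (λ i → u (suc i)) n
  sumTo-head u zero = +-comm _ _
  sumTo-head u (suc n) = begin
    sumTo u (suc n) + u (suc n)                    ≈⟨ +-cong (sumTo-head u n) refl ⟩
    (u 0 + sumTo (λ i → u (suc i)) n) + u (suc n)  ≈⟨ +-assoc _ _ _ ⟩
    u 0 + sumTo (λ i → u (suc i)) (suc n)          ∎

  sumTo-zero : ∀ {u} n → (∀ {i} → i < n → u i ≈ 0#) → sumTo u n ≈ 0#
  sumTo-zero zero _ = refl
  sumTo-zero (suc n) H =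
    trans (+-cong (sumTo-zero n (λ p → H (<-trans p (n<1+n n)))) (H (n<1+n n))) (+-identityˡ 0#)

  ⋆-last : ∀ u v n → (u ⋆ v) n ≈ sumTo (λ i → u i * v (n ∸ i)) n + u n * v 0
  ⋆-last u v n = +-cong refl (*-cong refl (reflexive (≡.cong v (n∸n≡0 n))))

  ⋆-first : ∀ u v n → (u ⋆ v) n ≈ u 0 * v n + sumTo (λ i → u (suc i) * v (n ∸ suc i)) n
  ⋆-first u v n = sumTo-head (λ i → u i * v (n ∸ i)) n

  oneS-shift : ∀ {n i} → i < n → oneS (n ∸ i) ≈ 0#
  oneS-shift {suc n} {zero} _ = refl
  oneS-shift {suc n} {suc i} (s≤s p) = oneS-shift p

  ⋆-identityʳ : ∀ u → (u ⋆ oneS) ≋ u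
  ⋆-identityʳ u n = begin
    (u ⋆ oneS) n                                   ≈⟨ ⋆-last u oneS n ⟩
    sumTo (λ i → u i * oneS (n ∸ i)) n + u n * 1#  ≈⟨ +-cong (sumTo-zero n (λ p → trans (*-cong refl (oneS-shift p)) (zeroʳ _))) (*-identityʳ _) ⟩
    0# + u n                                       ≈⟨ +-identityˡ _ ⟩
    u n                                            ∎

  powS-suc-0 : ∀ {u} → u 0 ≈ 0# → ∀ j → powS u (suc j) 0 ≈ 0#
  powS-suc-0 u0 j = trans (+-identityˡ _) (trans (*-cong u0 refl) (zeroˡ _))

  InSub-⊆ : ∀ {w v} → (∀ i → InSub v (w i)) → ∀ {x} → InSub w x → InSub v x
  InSub-⊆ H (gen i)    = H i
  InSub-⊆ H one        = one
  InSub-⊆ H (scal r p) = scal r (InSub-⊆ H p)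
  InSub-⊆ H (add p p′) = add (InSub-⊆ H p) (InSub-⊆ H p′)
  InSub-⊆ H (mul p p′) = mul (InSub-⊆ H p) (InSub-⊆ H p′)
  InSub-⊆ H (resp e p) = resp e (InSub-⊆ H p)

  SameSub-intro : ∀ {w v} → (∀ i → InSub v (w i)) → (∀ i → InSub w (v i)) → SameSub w v
  SameSub-intro w⊆v v⊆w _ = InSub-⊆ w⊆v , InSub-⊆ v⊆w

  SameSub-trans : ∀ {u v w} → SameSub u v → SameSub v w → SameSub u w
  SameSub-trans u≃v v≃w x = (λ p → proj₁ (v≃w x) (proj₁ (u≃v x) p))
                          , (λ p → proj₂ (u≃v x) (proj₂ (v≃w x) p))

  module _ {w : ℕ → Carrier} where

    InSub-≈0 : ∀ {x} → x ≈ 0# → InSub w x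
    InSub-≈0 x≈0 = resp (trans (·-zeroˡ 1#) (sym x≈0)) (scal K.0# one)

    InSub-neg : ∀ {x} → InSub w x → InSub w (- x)
    InSub-neg p = resp (-1·x≈-x _) (scal (K.- K.1#) p)

    InSub-alt : ∀ n {x} → InSub w x → InSub w (alt n x)
    InSub-alt zero p = p
    InSub-alt (suc n) p = InSub-neg (InSub-alt n p)

    InSub-alt⁻ : ∀ n {x} → InSub w (alt n x) → InSub w x
    InSub-alt⁻ zero p = p
    InSub-alt⁻ (suc n) p = InSub-alt⁻ n (resp (⁻¹-involutive _) (InSub-neg p))

    InSub-oneS : ∀ n → InSub w (oneS n)
    InSub-oneS zero = one
    InSub-oneS (suc n) = InSub-≈0 refl

    InSub-cancelʳ : ∀ {x y} → InSub w (x + y) → InSub w y → InSub w x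
    InSub-cancelʳ p r = resp (//-rightDividesʳ _ _) (add p (InSub-neg r))

    InSub-cancelˡ : ∀ {x y} → InSub w (x + y) → InSub w x → InSub w y
    InSub-cancelˡ p r = resp (\\-leftDividesʳ _ _) (add (InSub-neg r) p)

    InSub-sumTo : ∀ {u} n → (∀ {i} → i < n → InSub w (u i)) → InSub w (sumTo u n)
    InSub-sumTo zero _ = InSub-≈0 refl
    InSub-sumTo (suc n) H = add (InSub-sumTo n (λ p → H (<-trans p (n<1+n n)))) (H (n<1+n n))

    InSub-⋆ : ∀ {u v} n → (∀ {i} → i ≤ n → InSub w (u i)) → (∀ {i} → i ≤ n → InSub w (v i))
            → InSub w ((u ⋆ v) n)
    InSub-⋆ n Hu Hv = InSub-sumTo (suc n) (λ {i} i<1+n → mul (Hu (s≤s⁻¹ i<1+n)) (Hv (m∸n≤m n i)))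

    InSub-⋆-strict : ∀ {u v} n → u 0 ≈ 0# → v 0 ≈ 0#
                   → (∀ {i} → i < n → InSub w (u i)) → (∀ {i} → i < n → InSub w (v i))
                   → InSub w ((u ⋆ v) n)
    InSub-⋆-strict {u} {v} n u0 v0 Hu Hv =
      resp (sym (⋆-last u v n)) (add (InSub-sumTo n term) (InSub-≈0 (trans (*-cong refl v0) (zeroʳ _))))
      where
      term : ∀ {i} → i < n → InSub w (u i * v (n ∸ i))
      term {zero} _ = InSub-≈0 (trans (*-cong u0 refl) (zeroˡ _))
      term {suc i} p = mul (Hu p) (Hv (∸-suc< (<⇒≤ p)))

    InSub-⋆-leftFactor : ∀ {u v} → v 0 ≈ 1# → (∀ j → InSub w (v j))
                       → (∀ n → InSub w ((u ⋆ v) n)) → ∀ n → InSub w (u n)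
    InSub-⋆-leftFactor {u} {v} v0 Hv Huv = <-rec _ step
      where
      step : ∀ n → (∀ {i} → i < n → InSub w (u i)) → InSub w (u n)
      step n IH = resp (trans (*-cong refl v0) (*-identityʳ _))
        (InSub-cancelˡ (resp (⋆-last u v n) (Huv n)) (InSub-sumTo n (λ p → mul (IH p) (Hv _))))

    InSub-⋆-rightFactor : ∀ {u v} → u 0 ≈ 1# → (∀ i → InSub w (u i))
                        → (∀ n → InSub w ((u ⋆ v) n)) → ∀ n → InSub w (v n)
    InSub-⋆-rightFactor {u} {v} u0 Hu Huv = <-rec _ step
      where
      step : ∀ n → (∀ {i} → i < n → InSub w (v i)) → InSub w (v n)
      step n IH = resp (trans (*-cong u0 refl) (*-identityˡ _))
        (InSub-cancelʳ (resp (⋆-first u v n) (Huv n)) (InSub-sumTo n (λ p → mul (Hu _) (IH (∸-suc< p)))))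

    -- u_{n+1} = (n+1)⁻¹ (u')_n, the inverse being supplied by the ℚ-algebra structure.
    InSub-integrate : ∀ {u} → InSub w (u 0) → (∀ n → (∀ {i} → i ≤ n → InSub w (u i)) → InSub w (deriv u n))
                    → ∀ n → InSub w (u n)
    InSub-integrate {u} H0 Hderiv = <-rec _ step
      where
      step : ∀ n → (∀ {i} → i < n → InSub w (u i)) → InSub w (u n)
      step zero _ = H0
      step (suc n) IH = resp (inverse-·-fromℕK n _) (scal (proj₁ (q n)) (Hderiv n (λ i≤n → IH (s≤s i≤n))))

    InSub-powS : ∀ {u} → (∀ n → InSub w (u n)) → ∀ j n → InSub w (powS u j n)
    InSub-powS H zero n = InSub-oneS n
    InSub-powS H (suc j) n = InSub-⋆ n (λ {i} _ → H i) (λ {i} _ → InSub-powS H j i)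

    InSub-expS : ∀ {u} → (∀ n → InSub w (u n)) → ∀ n → InSub w (expS u n)
    InSub-expS H n = InSub-sumTo (suc n) (λ {j} _ → scal (invFact j) (InSub-powS H j n))

    InSub-powS-strict : ∀ {u n} → u 0 ≈ 0# → (∀ {i} → i < n → InSub w (u i))
                      → ∀ j {i} → i < n → InSub w (powS u (suc j) i)
    InSub-powS-strict {u} u0 H zero {i} p = resp (sym (⋆-identityʳ u i)) (H p)
    InSub-powS-strict u0 H (suc j) {i} p =
      InSub-⋆-strict i u0 (powS-suc-0 u0 j) (λ r → H (<-trans r p)) (λ r → InSub-powS-strict u0 H j (<-trans r p))

    -- In e^u = 1 + u + Σ_{j≥2} u^j/j!, the powers u^j with j ≥ 2 only see lower coefficients of u.
    InSub-log : ∀ {u} → u 0 ≈ 0# → (∀ n → InSub w (expS u n)) → ∀ n → InSub w (u n)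
    InSub-log {u} u0 Hexp = <-rec _ step
      where
      T : ℕ → ℕ → Carrier
      T n j = invFact j · powS u j n
      T1≈u : ∀ n → T n 1 ≈ u n
      T1≈u n = trans (·-cong invFact-1 (⋆-identityʳ u n)) (·-identity _)
      expS-split : ∀ n → expS u (suc n) ≈ T (suc n) 0 + (T (suc n) 1 + sumTo (λ j → T (suc n) (suc (suc j))) n)
      expS-split n = trans (sumTo-head (T (suc n)) (suc n)) (+-cong refl (sumTo-head (λ j → T (suc n) (suc j)) n))
      step : ∀ n → (∀ {i} → i < n → InSub w (u i)) → InSub w (u n)
      step zero _ = InSub-≈0 u0
      step (suc n) IH = resp (T1≈u (suc n))
        (InSub-cancelʳ (InSub-cancelˡ (resp (expS-split n) (Hexp (suc n))) (scal K.1# (InSub-oneS (suc n))))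
                       (InSub-sumTo n (λ {j} _ → scal (invFact (suc (suc j)))
                          (InSub-⋆-strict (suc n) u0 (powS-suc-0 u0 j) IH (InSub-powS-strict u0 IH j)))))

  module NCS {f g d h m : PS} (ncs : IsNCS f g d h m) where
    open IsNCS ncs

    g0≈1 : g 0 ≈ 1#
    g0≈1 = begin
      g 0              ≈⟨ sym (*-identityˡ _) ⟩
      1# * g 0         ≈⟨ *-cong (sym f0) refl ⟩
      f 0 * g 0        ≈⟨ sym (+-identityˡ _) ⟩
      0# + f 0 * g 0   ≈⟨ fg-inv 0 ⟩
      1#               ∎

    f∈⟨λ⟩ : ∀ n → InSub (lamSeq f) (f n)
    f∈⟨λ⟩ zero = resp (sym f0) one
    f∈⟨λ⟩ (suc n) = gen n

    g∈⟨s⟩ : ∀ n → InSub (sSeq g) (g n)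
    g∈⟨s⟩ zero = resp (sym g0≈1) one
    g∈⟨s⟩ (suc n) = gen n

    g'∈⟨s⟩ : ∀ n → InSub (sSeq g) (deriv g n)
    g'∈⟨s⟩ n = scal (fromℕK K (suc n)) (gen n)

    g∈⟨λ⟩ : ∀ n → InSub (lamSeq f) (g n)
    g∈⟨λ⟩ = InSub-⋆-leftFactor f0 (λ j → InSub-alt j (f∈⟨λ⟩ j)) (λ n → resp (sym (gf-inv n)) (InSub-oneS n))

    f∈⟨s⟩ : ∀ n → InSub (sSeq g) (f n)
    f∈⟨s⟩ n = InSub-alt⁻ n (InSub-⋆-leftFactor g0≈1 g∈⟨s⟩ (λ n → resp (sym (fg-inv n)) (InSub-oneS n)) n)

    h∈⟨s⟩ : ∀ n → InSub (sSeq g) (h n)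
    h∈⟨s⟩ = InSub-⋆-rightFactor g0≈1 g∈⟨s⟩ (λ n → resp (g'-gh n) (g'∈⟨s⟩ n))

    m∈⟨s⟩ : ∀ n → InSub (sSeq g) (m n)
    m∈⟨s⟩ = InSub-⋆-leftFactor g0≈1 g∈⟨s⟩ (λ n → resp (g'-mg n) (g'∈⟨s⟩ n))

    d∈⟨s⟩ : ∀ n → InSub (sSeq g) (d n)
    d∈⟨s⟩ = InSub-log d0 (λ n → resp (sym (exp-d n)) (g∈⟨s⟩ n))

    g∈⟨ψ⟩ : ∀ n → InSub (psiSeq h) (g n)
    g∈⟨ψ⟩ = InSub-integrate (resp (sym g0≈1) one)
      (λ n IH → resp (sym (g'-gh n)) (InSub-⋆ n IH (λ {i} _ → gen i)))

    g∈⟨ξ⟩ : ∀ n → InSub (xiSeq m) (g n)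
    g∈⟨ξ⟩ = InSub-integrate (resp (sym g0≈1) one)
      (λ n IH → resp (sym (g'-mg n)) (InSub-⋆ n (λ {i} _ → gen i) IH))

    d∈⟨φ⟩ : ∀ n → InSub (phiSeq d) (d n)
    d∈⟨φ⟩ zero = InSub-≈0 d0
    d∈⟨φ⟩ (suc n) = resp (inverse-·-fromℕK n _) (scal (proj₁ (q n)) (gen n))

    g∈⟨φ⟩ : ∀ n → InSub (phiSeq d) (g n)
    g∈⟨φ⟩ n = resp (exp-d n) (InSub-expS d∈⟨φ⟩ n)

    ⟨s⟩≃⟨λ⟩ : SameSub (sSeq g) (lamSeq f)
    ⟨s⟩≃⟨λ⟩ = SameSub-intro (λ i → g∈⟨λ⟩ (suc i)) (λ i → f∈⟨s⟩ (suc i))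

    ⟨φ⟩≃⟨s⟩ : SameSub (phiSeq d) (sSeq g)
    ⟨φ⟩≃⟨s⟩ = SameSub-intro (λ i → scal (fromℕK K (suc i)) (d∈⟨s⟩ (suc i))) (λ i → g∈⟨φ⟩ (suc i))

    ⟨ψ⟩≃⟨s⟩ : SameSub (psiSeq h) (sSeq g)
    ⟨ψ⟩≃⟨s⟩ = SameSub-intro h∈⟨s⟩ (λ i → g∈⟨ψ⟩ (suc i))

    ⟨ξ⟩≃⟨s⟩ : SameSub (xiSeq m) (sSeq g)
    ⟨ξ⟩≃⟨s⟩ = SameSub-intro m∈⟨s⟩ (λ i → g∈⟨ξ⟩ (suc i))

corollary2p8 : ∀ {k kℓ a aℓ} (K : CommutativeRing k kℓ) (A : Ring a aℓ)
    (alg : IsKAlgebra K A) (q : IsQAlgebra K)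
    (f g d h m : Series.PS alg q) →
    Series.IsNCS alg q f g d h m →
    Series.SameSub alg q (Series.sSeq alg q g) (Series.lamSeq alg q f)
    × Series.SameSub alg q (Series.phiSeq alg q d) (Series.lamSeq alg q f)
    × Series.SameSub alg q (Series.psiSeq alg q h) (Series.lamSeq alg q f)
    × Series.SameSub alg q (Series.xiSeq alg q m) (Series.lamSeq alg q f)
corollary2p8 K A alg q f g d h m ncs =
    ⟨s⟩≃⟨λ⟩
  , SameSub-trans alg q ⟨φ⟩≃⟨s⟩ ⟨s⟩≃⟨λ⟩
  , SameSub-trans alg q ⟨ψ⟩≃⟨s⟩ ⟨s⟩≃⟨λ⟩
  , SameSub-trans alg q ⟨ξ⟩≃⟨s⟩ ⟨s⟩≃⟨λ⟩
  where open NCS alg q ncs
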